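{- Let $T$ be a tree with at least two vertices, let $v$ be a vertex of $T$, and suppose $mttr(v,T)=t$. Then for every $i$ with $1\leq i\leq t$ there exists a modified-total transitive partition $\{V_1,V_2,\dots,V_i\}$ of $T$ such that $v\in V_i$.
   Context: For disjoint vertex subsets $A,B$ of a graph, $A$ m-totally dominates $B$ if every vertex of $A\cup B$ is adjacent to some vertex of $A$. A modified-total transitive partition of order $k$ of a graph $G=(V,E)$ is a partition $\{V_1,\dots,V_k\}$ of $V$ into nonempty sets such that for all $1\leq i<j\leq k$, $V_i$ m-totally dominates $V_j$. The modified-total transitive number $mttr(v,T)$ of a vertex $v$ is the maximum integer $p$ such that $v\in V_p$ for some modified-total transitive partition $\{V_1,\dots,V_k\}$ of $T$, the maximum taken over all modified-total transitive partitions of $T$. -}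

module Defs where

open import Data.Nat using (ℕ; zero; suc; _≤_; _<_; _+_)
open import Data.Fin using (Fin; toℕ)
open import Data.List using (List; []; _∷_; length)
open import Data.List.Relation.Unary.Unique.Propositional using (Unique)
open import Data.Product using (Σ; ∃; _×_; _,_)
open import Relation.Binary.PropositionalEquality using (_≡_)
open import Relation.Nullary using (¬_)
open import Data.Unit using (⊤)
open import Data.Sum using (_⊎_)

record Graph (n : ℕ) : Set₁ where
  field
    Adj       : Fin n → Fin n → Set
    symmetric : ∀ {x y} → Adj x y → Adj y x
    irreflex  : ∀ {x} → ¬ Adj x x
open Graph public

Chain : ∀ {n} → Graph n → List (Fin n) → Set
Chain G []           = ⊤
Chain G (x ∷ [])     = ⊤
Chain G (x ∷ y ∷ xs) = Adj G x y × Chain G (y ∷ xs)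

data Walk {n} (G : Graph n) : Fin n → Fin n → Set where
  here : ∀ {x} → Walk G x x
  step : ∀ {x y z} → Adj G x y → Walk G y z → Walk G x z

Connected : ∀ {n} → Graph n → Set
Connected G = ∀ x y → Walk G x y

last : ∀ {n} → Fin n → List (Fin n) → Fin n
last x []       = x
last x (y ∷ ys) = last y ys

HasCycle : ∀ {n} → Graph n → Set
HasCycle G = Σ _ λ x → Σ _ λ xs →
  (2 ≤ length xs) × Unique (x ∷ xs) × Chain G (x ∷ xs) × Adj G (last x xs) x

IsTree : ∀ {n} → Graph n → Set
IsTree G = Connected G × ¬ HasCycle G

-- A m-totally dominates B (A, B given as predicates on vertices):
-- every vertex of A ∪ B is adjacent to some vertex of A.
-- For a partition f : Fin n → Fin k, V_i = { x | f x ≡ i }.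
MTDom : ∀ {n k} → Graph n → (Fin n → Fin k) → Fin k → Fin k → Set
MTDom G f i j = ∀ x → (f x ≡ i) ⊎ (f x ≡ j) →
                ∃ λ y → f y ≡ i × Adj G x y

-- Modified-total transitive partition of order k: f assigns to each vertex
-- its part (Fin k, index 0 ↔ V_1); all parts nonempty; V_i m-totally
-- dominates V_j for i < j.
IsMTTPartition : ∀ {n} → Graph n → (k : ℕ) → (Fin n → Fin k) → Set
IsMTTPartition G k f =
  (∀ i → ∃ λ x → f x ≡ i) ×
  (∀ i j → toℕ i < toℕ j → MTDom G f i j)

-- v ∈ V_p for some mtt-partition (p is 1-based).
InPartAt : ∀ {n : ℕ} → Graph n → Fin n → ℕ → Set
InPartAt {n} G v p = Σ ℕ λ k → Σ (Fin n → Fin k) λ f →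
  IsMTTPartition G k f × suc (toℕ (f v)) ≡ p

MttrIs : ∀ {n} → Graph n → Fin n → ℕ → Set
MttrIs G v t = InPartAt G v t × (∀ p → InPartAt G v p → p ≤ t)

{-# OPTIONS --safe #-}
-- Merging the parts V_{m+1}, …, V_k of an mtt-partition into one part keeps it an
-- mtt-partition, and a vertex of V_p with p > m lands in the new last part.
module Submission where

open import Defs
open import Data.Nat using (ℕ; _≤_; suc; _<_; _⊓_; s≤s; s≤s⁻¹)
open import Data.Nat.Properties
  using (≤-total; <-irrefl; <-≤-trans; m⊓n≤m; m⊓n≤n; m≤n⇒m⊓n≡m; m≥n⇒m⊓n≡n)
open import Data.Fin using (Fin; toℕ; fromℕ<; inject≤)
open import Data.Fin.Properties using (toℕ-fromℕ<; toℕ-inject≤; toℕ-injective; toℕ<n)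
open import Data.Product using (Σ; _×_; _,_)
open import Data.Sum using (inj₁; inj₂)
open import Data.Empty using (⊥-elim)
open import Function using (_∘_)
open import Relation.Binary.PropositionalEquality using (_≡_; refl; sym; trans; cong; subst; subst₂; module ≡-Reasoning)

clamp : ∀ {k} (m : ℕ) → Fin k → Fin (suc m)
clamp m a = fromℕ< (s≤s (m⊓n≤n (toℕ a) m))

module _ {k m : ℕ} (a : Fin k) where

  toℕ-clamp : toℕ (clamp m a) ≡ toℕ a ⊓ m
  toℕ-clamp = toℕ-fromℕ< (s≤s (m⊓n≤n (toℕ a) m))

  toℕ-clamp-≤ : toℕ a ≤ m → toℕ (clamp m a) ≡ toℕ a
  toℕ-clamp-≤ a≤m = trans toℕ-clamp (m≤n⇒m⊓n≡m a≤m)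

  toℕ-clamp-≥ : m ≤ toℕ a → toℕ (clamp m a) ≡ m
  toℕ-clamp-≥ m≤a = trans toℕ-clamp (m≥n⇒m⊓n≡n m≤a)

  toℕ-clamp-≤-toℕ : toℕ (clamp m a) ≤ toℕ a
  toℕ-clamp-≤-toℕ = subst (_≤ toℕ a) (sym toℕ-clamp) (m⊓n≤m (toℕ a) m)

  toℕ-clamp-< : toℕ (clamp m a) < m → toℕ (clamp m a) ≡ toℕ a
  toℕ-clamp-< c<m with ≤-total (toℕ a) m
  ... | inj₁ a≤m = toℕ-clamp-≤ a≤m
  ... | inj₂ m≤a = ⊥-elim (<-irrefl (toℕ-clamp-≥ m≤a) c<m)

clamp-inject≤ : ∀ {k m} (j : Fin (suc m)) (m<k : m < k) → clamp m (inject≤ j m<k) ≡ j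
clamp-inject≤ j m<k = toℕ-injective (trans
  (toℕ-clamp-≤ (inject≤ j m<k) (subst (_≤ _) (sym (toℕ-inject≤ j m<k)) (s≤s⁻¹ (toℕ<n j))))
  (toℕ-inject≤ j m<k))

module _ {n k m : ℕ} (G : Graph n) (f : Fin n → Fin k) (m<k : m < k) where

  clamp-nonempty : (∀ j → Σ (Fin n) λ x → f x ≡ j) →
                   ∀ j → Σ (Fin n) λ x → clamp m (f x) ≡ j
  clamp-nonempty nonempty j with nonempty (inject≤ j m<k)
  ... | x , fx≡ = x , trans (cong (clamp m) fx≡) (clamp-inject≤ j m<k)

  dominator-clamp : ∀ i {x} → (Σ (Fin n) λ y → f y ≡ inject≤ i m<k × Adj G x y) →
                    Σ (Fin n) λ y → clamp m (f y) ≡ i × Adj G x y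
  dominator-clamp i (y , fy≡ , adj) = y , trans (cong (clamp m) fy≡) (clamp-inject≤ i m<k) , adj

  -- A vertex of the new part i < m lies in the old part i, which is dominated by the
  -- old part m; a vertex of the new part j lies in an old part above j > i.
  clamp-MTDom : (∀ i j → toℕ i < toℕ j → MTDom G f i j) →
                ∀ i j → toℕ i < toℕ j → MTDom G (clamp m ∘ f) i j
  clamp-MTDom dom i j i<j x (inj₁ gx≡i) =
    dominator-clamp i (dom (inject≤ i m<k) (fromℕ< m<k) i<top x (inj₁ fx≡i))
    where
    i<m : toℕ i < m
    i<m = <-≤-trans i<j (s≤s⁻¹ (toℕ<n j))

    fx≡i : f x ≡ inject≤ i m<k
    fx≡i = toℕ-injective (begin
      toℕ (f x)              ≡⟨ sym (toℕ-clamp-< (f x) (subst (_< m) (cong toℕ (sym gx≡i)) i<m)) ⟩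
      toℕ (clamp m (f x))    ≡⟨ cong toℕ gx≡i ⟩
      toℕ i                  ≡⟨ sym (toℕ-inject≤ i m<k) ⟩
      toℕ (inject≤ i m<k)    ∎)
      where open ≡-Reasoning

    i<top : toℕ (inject≤ i m<k) < toℕ (fromℕ< m<k)
    i<top = subst₂ _<_ (sym (toℕ-inject≤ i m<k)) (sym (toℕ-fromℕ< m<k)) i<m
  clamp-MTDom dom i j i<j x (inj₂ gx≡j) =
    dominator-clamp i (dom (inject≤ i m<k) (f x) i<fx x (inj₂ refl))
    where
    i<fx : toℕ (inject≤ i m<k) < toℕ (f x)
    i<fx = subst (_< toℕ (f x)) (sym (toℕ-inject≤ i m<k))
             (<-≤-trans i<j (subst (_≤ toℕ (f x)) (cong toℕ gx≡j) (toℕ-clamp-≤-toℕ (f x))))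

  clamp-IsMTTPartition : IsMTTPartition G k f → IsMTTPartition G (suc m) (clamp m ∘ f)
  clamp-IsMTTPartition (nonempty , dom) = clamp-nonempty nonempty , clamp-MTDom dom

lemma7 : ∀ {n} (T : Graph n) → 2 ≤ n → IsTree T → (v : Fin n) → (t : ℕ) →
    MttrIs T v t → ∀ i → 1 ≤ i → i ≤ t →
    Σ (Fin n → Fin i) λ f → IsMTTPartition T i f × suc (toℕ (f v)) ≡ i
lemma7 T _ _ v t ((k , f , isPartition , v∈Vt) , _) (suc m) _ i≤t =
  clamp m ∘ f , clamp-IsMTTPartition T f m<k isPartition , cong suc (toℕ-clamp-≥ (f v) m≤fv)
  where
  m≤fv : m ≤ toℕ (f v)
  m≤fv = s≤s⁻¹ (subst (suc m ≤_) (sym v∈Vt) i≤t)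

  m<k : m < k
  m<k = <-≤-trans (s≤s m≤fv) (toℕ<n (f v))
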